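{- Every positive integer of the form $m^2$, $m(m-1)$, or $m^2-1$ (with $m$ an integer) is an almost-square.
   Context: For a positive integer $n$, let $s(n)=\min_{d\mid n}(d+n/d)$ and $F(n)=n/s(n)$. A positive integer $n$ is an almost-square if $F(k)\le F(n)$ for all positive integers $k\le n$. -}

module Defs where

open import Data.Nat using (ℕ; zero; suc; _+_; _≤_; _<_; _⊓_)
open import Data.Nat.DivMod using (_/_)
open import Data.Nat.Divisibility using (_∣?_)
open import Data.List using (List; foldr; map; filter; upTo)
open import Data.Integer using (+_)
open import Data.Rational using (ℚ) renaming (_/_ to _÷_; _≤_ to _≤ℚ_)
open import Data.Product using (_×_)

-- Divisors d = suc i of n, for i < n (all divisors of a positive n).
-- s n = min over divisors d ∣ n of (d + n / d).
-- Written as suc (min_{d∣n} ((d - 1) + n / d)) so that s n is syntactically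
-- nonzero; the inner fold starts at n, which is attained (d = n gives
-- (n - 1) + 1 = n) whenever n ≥ 1, so it does not affect the minimum.
s : ℕ → ℕ
s n = suc (foldr _⊓_ n (map (λ i → i + n / suc i) (filter (λ i → suc i ∣? n) (upTo n))))

F : ℕ → ℚ
F n = (+ n) ÷ s n

AlmostSquare : ℕ → Set
AlmostSquare n = 0 < n × (∀ k → 0 < k → k ≤ n → F k ≤ℚ F n)

module Submission where

-- Every divisor pair d · (k/d) = k satisfies (d + k/d)² ≥ 4k, so s(k)² ≥ 4k for all k.
-- Suppose s(n) ≤ c with c(c − 1) ≤ 4n, and let k ≤ n. If s(k) ≥ c then s(k) ≥ s(n) and
-- F(k) ≤ F(n) is immediate; otherwise s(k) ≤ c − 1, so s(k) · c ≤ 4n and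
-- 4k · s(n) ≤ s(k)² · c ≤ 4n · s(k). For n = a(a + t) the divisor pair a, a + t gives
-- c = 2a + t, and c² = 4n + t², so the condition reads t² ≤ 2a + t, which holds for
-- t ≤ 2 and a ≥ 1. These are exactly the numbers m², m(m − 1) and m² − 1 = (m − 1)(m + 1).

open import Defs

-- A separate scope, so that ℕ's operators do not clash with ℤ's in the statement of lemma3.
module _ where

  open import Data.Nat
  open import Data.Nat.Properties
  open import Data.Nat.DivMod using (m*n/n≡m; m*[n/m]≡n)
  open import Data.Nat.Divisibility using (_∣_; _∣?_; ∣⇒≤; n∣m*n)
  open import Data.Nat.Tactic.RingSolver using (solve-∀)
  open import Data.List using (List; map; filter; upTo)
  open import Data.List.Properties using (foldr-preservesᵇ; foldr-preservesᵒ)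
  open import Data.List.Membership.Propositional using (_∈_)
  open import Data.List.Membership.Propositional.Properties using (∈-map⁺; ∈-filter⁺; ∈-upTo⁺)
  import Data.List.Relation.Unary.All as All
  open import Data.List.Relation.Unary.All.Properties using (map⁺; all-filter)
  import Data.List.Relation.Unary.Any as Any
  import Data.Integer as ℤ
  import Data.Integer.Properties as ℤ
  open import Data.Rational using (fromℚᵘ) renaming (_≤_ to _≤ℚ_)
  import Data.Rational.Properties as ℚ
  open import Data.Rational.Unnormalised using (mkℚᵘ; *≤*) renaming (_≤_ to _≤ᵘ_)
  import Data.Rational.Unnormalised.Properties as ℚᵘ
  open import Data.Product using (_,_)
  open import Data.Sum using (_⊎_; inj₁; inj₂; [_,_]′)
  open import Function using (_∘_)
  open import Relation.Binary.PropositionalEquality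
  open import Relation.Nullary using (yes; no)
  open ≤-Reasoning

  fromℚᵘ-mono-≤ : ∀ {p q} → p ≤ᵘ q → fromℚᵘ p ≤ℚ fromℚᵘ q
  fromℚᵘ-mono-≤ {p} {q} p≤q = ℚ.toℚᵘ-cancel-≤
    (ℚᵘ.≤-respˡ-≃ (ℚᵘ.≃-sym (ℚ.toℚᵘ-fromℚᵘ p)) (ℚᵘ.≤-respʳ-≃ (ℚᵘ.≃-sym (ℚ.toℚᵘ-fromℚᵘ q)) p≤q))

  F-≤ : ∀ {k n} → k * s n ≤ n * s k → F k ≤ℚ F n
  F-≤ {k} {n} k*sn≤n*sk = fromℚᵘ-mono-≤ {mkℚᵘ (ℤ.+ k) (pred (s k))} {mkℚᵘ (ℤ.+ n) (pred (s n))}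
    (*≤* (subst₂ ℤ._≤_ (ℤ.pos-* k (s n)) (ℤ.pos-* n (s k)) (ℤ.+≤+ k*sn≤n*sk)))

  sum²≡4*product+difference² : ∀ m t → (m + (t + m)) * (m + (t + m)) ≡ 4 * (m * (t + m)) + t * t
  sum²≡4*product+difference² = solve-∀

  m≤n⇒4*[m*n]≤[m+n]*[m+n] : ∀ {m n} → m ≤ n → 4 * (m * n) ≤ (m + n) * (m + n)
  m≤n⇒4*[m*n]≤[m+n]*[m+n] {m} {n} m≤n with n ∸ m | m∸n+n≡m m≤n
  ... | t | refl = begin
    4 * (m * (t + m))             ≤⟨ m≤m+n _ (t * t) ⟩
    4 * (m * (t + m)) + t * t     ≡⟨ sum²≡4*product+difference² m t ⟨
    (m + (t + m)) * (m + (t + m)) ∎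

  4*[m*n]≤[m+n]*[m+n] : ∀ m n → 4 * (m * n) ≤ (m + n) * (m + n)
  4*[m*n]≤[m+n]*[m+n] m n with ≤-total m n
  ... | inj₁ m≤n = m≤n⇒4*[m*n]≤[m+n]*[m+n] m≤n
  ... | inj₂ n≤m = subst₂ _≤_ (cong (4 *_) (*-comm n m)) (cong (λ k → k * k) (+-comm n m))
                     (m≤n⇒4*[m*n]≤[m+n]*[m+n] n≤m)

  pred-s-candidates : ℕ → List ℕ
  pred-s-candidates n = map (λ i → i + n / suc i) (filter (λ i → suc i ∣? n) (upTo n))

  ⊓-preservesᵇ : ∀ (P : ℕ → Set) {x y} → P x → P y → P (x ⊓ y)
  ⊓-preservesᵇ P {x} {y} Px Py =
    [ (λ x⊓y≡x → subst P (sym x⊓y≡x) Px) , (λ x⊓y≡y → subst P (sym x⊓y≡y) Py) ]′ (⊓-sel x y)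

  4*n≤s[n]*s[n] : ∀ n → 4 * n ≤ s n * s n
  4*n≤s[n]*s[n] n = foldr-preservesᵇ {P = P} (λ {x} {y} → ⊓-preservesᵇ P {x} {y}) P[n]
    (map⁺ (All.map P[candidate] (all-filter (λ i → suc i ∣? n) (upTo n))))
    where
    P : ℕ → Set
    P x = 4 * n ≤ suc x * suc x

    P[n] : P n
    P[n] = subst (λ k → 4 * k ≤ suc n * suc n) (*-identityˡ n) (4*[m*n]≤[m+n]*[m+n] 1 n)

    P[candidate] : ∀ {i} → suc i ∣ n → P (i + n / suc i)
    P[candidate] {i} i+1∣n = subst (λ k → 4 * k ≤ suc (i + n / suc i) * suc (i + n / suc i))
      (m*[n/m]≡n i+1∣n) (4*[m*n]≤[m+n]*[m+n] (suc i) (n / suc i))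

  s≤d+n/d : ∀ {d n} .{{_ : NonZero d}} .{{_ : NonZero n}} → d ∣ n → s n ≤ d + n / d
  s≤d+n/d {suc i} {n} d∣n =
    s≤s (foldr-preservesᵒ {P = _≤ i + n / suc i} ⊓-≤ n (pred-s-candidates n)
      (inj₂ (Any.map (≤-reflexive ∘ sym) candidate)))
    where
    ⊓-≤ : ∀ x y → x ≤ i + n / suc i ⊎ y ≤ i + n / suc i → x ⊓ y ≤ i + n / suc i
    ⊓-≤ x y = [ m≤n⇒m⊓o≤n y , m≤n⇒o⊓m≤n x ]′

    candidate : i + n / suc i ∈ pred-s-candidates n
    candidate = ∈-map⁺ (λ i → i + n / suc i) (∈-filter⁺ (λ i → suc i ∣? n) (∈-upTo⁺ (∣⇒≤ d∣n)) d∣n)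

  s[m*n]≤m+n : ∀ {m n} → 0 < m → 0 < n → s (m * n) ≤ m + n
  s[m*n]≤m+n {suc m} {suc n} _ _ = begin
    s (suc m * suc n)              ≤⟨ s≤d+n/d {suc n} {suc m * suc n} (n∣m*n (suc m)) ⟩
    suc n + suc m * suc n / suc n  ≡⟨ cong (suc n +_) (m*n/n≡m (suc m) (suc n)) ⟩
    suc n + suc m                  ≡⟨ +-comm (suc n) (suc m) ⟩
    suc m + suc n                  ∎

  k*b≤n*a : ∀ {k n a b c} → k ≤ n → 4 * k ≤ a * a → b ≤ c → c * c ≤ 4 * n + c → k * b ≤ n * a
  k*b≤n*a {k} {n} {a} {b} {c} k≤n 4k≤a*a b≤c c*c≤4n+c with c ≤? a
  ... | yes c≤a = *-mono-≤ k≤n (≤-trans b≤c c≤a)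
  ... | no c≰a = *-cancelˡ-≤ 4 (begin
    4 * (k * b)   ≤⟨ *-monoʳ-≤ 4 (*-monoʳ-≤ k b≤c) ⟩
    4 * (k * c)   ≡⟨ *-assoc 4 k c ⟨
    4 * k * c     ≤⟨ *-monoˡ-≤ c 4k≤a*a ⟩
    a * a * c     ≡⟨ *-assoc a a c ⟩
    a * (a * c)   ≤⟨ *-monoʳ-≤ a a*c≤4n ⟩
    a * (4 * n)   ≡⟨ *-comm a (4 * n) ⟩
    4 * n * a     ≡⟨ *-assoc 4 n a ⟩
    4 * (n * a)   ∎)
    where
    a*c≤4n : a * c ≤ 4 * n
    a*c≤4n = +-cancelˡ-≤ c _ _ (begin
      suc a * c     ≤⟨ *-monoˡ-≤ c (≰⇒> c≰a) ⟩
      c * c         ≤⟨ c*c≤4n+c ⟩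
      4 * n + c     ≡⟨ +-comm (4 * n) c ⟩
      c + 4 * n     ∎)

  almostSquare-criterion : ∀ {n c} → 0 < n → s n ≤ c → c * c ≤ 4 * n + c → AlmostSquare n
  almostSquare-criterion {n} 0<n sn≤c c*c≤4n+c = 0<n , λ k _ k≤n →
    F-≤ {k} {n} (k*b≤n*a {a = s k} k≤n (4*n≤s[n]*s[n] k) sn≤c c*c≤4n+c)

  almostSquare-a*[t+a] : ∀ {a} t → 0 < a → t * t ≤ a + (t + a) → AlmostSquare (a * (t + a))
  almostSquare-a*[t+a] {a} t 0<a t*t≤2a+t =
    almostSquare-criterion (*-mono-< 0<a 0<t+a) (s[m*n]≤m+n 0<a 0<t+a) (begin
      (a + (t + a)) * (a + (t + a))      ≡⟨ sum²≡4*product+difference² a t ⟩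
      4 * (a * (t + a)) + t * t          ≤⟨ +-monoʳ-≤ (4 * (a * (t + a))) t*t≤2a+t ⟩
      4 * (a * (t + a)) + (a + (t + a))  ∎)
    where
    0<t+a : 0 < t + a
    0<t+a = ≤-trans 0<a (m≤n+m a t)

  almostSquare-a*a : ∀ {a} → 0 < a → AlmostSquare (a * a)
  almostSquare-a*a 0<a = almostSquare-a*[t+a] 0 0<a z≤n

  almostSquare-a*[1+a] : ∀ {a} → 0 < a → AlmostSquare (a * suc a)
  almostSquare-a*[1+a] {a} 0<a = almostSquare-a*[t+a] 1 0<a (m≤n⇒m≤o+n a (s≤s z≤n))

  almostSquare-a*a∸1 : ∀ {a} → 1 < a → AlmostSquare (a * a ∸ 1)
  almostSquare-a*a∸1 {suc zero}    (s≤s ())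
  almostSquare-a*a∸1 {suc (suc b)} _ = subst AlmostSquare (*-suc (suc b) (suc (suc b)))
    (almostSquare-a*[t+a] 2 z<s (s≤s (m≤n⇒m≤o+n b (s≤s (s≤s (s≤s z≤n))))))

  +n≡m*m⇒AlmostSquare : ∀ {n} m → 0 < n → ℤ.+ n ≡ m ℤ.* m → AlmostSquare n
  +n≡m*m⇒AlmostSquare (ℤ.+ zero)  () refl
  +n≡m*m⇒AlmostSquare (ℤ.+ suc a) _  refl = almostSquare-a*a {suc a} z<s
  +n≡m*m⇒AlmostSquare ℤ.-[1+ a ]  _  refl = almostSquare-a*a {suc a} z<s

  +n≡m*[m-1]⇒AlmostSquare : ∀ {n} m → 0 < n → ℤ.+ n ≡ m ℤ.* (m ℤ.- ℤ.1ℤ) → AlmostSquare n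
  +n≡m*[m-1]⇒AlmostSquare (ℤ.+ zero)        () refl
  +n≡m*[m-1]⇒AlmostSquare (ℤ.+ suc zero)    () refl
  +n≡m*[m-1]⇒AlmostSquare (ℤ.+ suc (suc a)) _  refl =
    subst AlmostSquare (*-comm (suc a) (suc (suc a))) (almostSquare-a*[1+a] {suc a} z<s)
  -- Here m - 1 computes to -[1+ suc (a + 0) ].
  +n≡m*[m-1]⇒AlmostSquare ℤ.-[1+ a ]         _  refl =
    subst (λ b → AlmostSquare (suc a * suc (suc b))) (sym (+-identityʳ a))
      (almostSquare-a*[1+a] {suc a} z<s)

  +n≡m*m-1⇒AlmostSquare : ∀ {n} m → 0 < n → ℤ.+ n ≡ m ℤ.* m ℤ.- ℤ.1ℤ → AlmostSquare n
  +n≡m*m-1⇒AlmostSquare (ℤ.+ suc zero)    () refl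
  +n≡m*m-1⇒AlmostSquare (ℤ.+ suc (suc a)) _  refl = almostSquare-a*a∸1 {suc (suc a)} (s≤s (s≤s z≤n))
  +n≡m*m-1⇒AlmostSquare ℤ.-[1+ zero ]     () refl
  +n≡m*m-1⇒AlmostSquare ℤ.-[1+ suc a ]    _  refl = almostSquare-a*a∸1 {suc (suc a)} (s≤s (s≤s z≤n))

open import Data.Nat using (ℕ; _<_)
open import Data.Integer using (ℤ; +_; _*_; _-_; 1ℤ)
open import Data.Product using (∃-syntax; _,_)
open import Data.Sum using (_⊎_; inj₁; inj₂)
open import Relation.Binary.PropositionalEquality using (_≡_)

lemma3 : ∀ (n : ℕ) → 0 < n →
           (∃[ m ] ((+ n ≡ m * m) ⊎ (+ n ≡ m * (m - 1ℤ)) ⊎ (+ n ≡ m * m - 1ℤ))) →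
           AlmostSquare n
lemma3 n 0<n (m , inj₁ n≡m*m)            = +n≡m*m⇒AlmostSquare m 0<n n≡m*m
lemma3 n 0<n (m , inj₂ (inj₁ n≡m*[m-1])) = +n≡m*[m-1]⇒AlmostSquare m 0<n n≡m*[m-1]
lemma3 n 0<n (m , inj₂ (inj₂ n≡m*m-1))   = +n≡m*m-1⇒AlmostSquare m 0<n n≡m*m-1
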